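{- Let $H$ be a graph, $X(H)$ its clique complex, $k\ge 0$, and let $\gamma$ be a $k$-cycle of $X(H)$ with integer coefficients representing a nonzero class in $\widetilde H_k(X(H),\mathbb{Z})$. Then $|\mathrm{vsupp}(\gamma)|\ge 2k+2$.
   Context: The clique complex $X(H)$ of a graph $H$ is the simplicial complex whose faces are the vertex sets of complete subgraphs of $H$. The vertex support $\mathrm{vsupp}(\gamma)$ of a chain $\gamma$ is the set of vertices lying in some face with nonzero coefficient in $\gamma$. $\widetilde H_k$ denotes reduced simplicial homology. -}

module Defs where

open import Data.Nat using (ℕ; zero; suc)
open import Data.Fin using (Fin; zero; suc; toℕ; _<_)
open import Data.Vec using (Vec; lookup; insertAt)
open import Data.Integer using (ℤ; _+_; _*_; -_; 0ℤ; 1ℤ)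
open import Data.List using (List; length)
open import Data.List.Membership.Propositional using (_∈_)
open import Data.List.Relation.Unary.All using (All)
open import Data.List.Relation.Unary.Unique.Propositional using (Unique)
open import Data.Product using (Σ; ∃; _×_)
open import Relation.Binary.PropositionalEquality using (_≡_; _≢_)
open import Relation.Nullary using (¬_)
open import Data.Empty using (⊥)

record Graph (n : ℕ) : Set₁ where
  field
    Adj     : Fin n → Fin n → Set
    sym     : ∀ {u v} → Adj u v → Adj v u
    irrefl  : ∀ {v} → ¬ Adj v v
open Graph public

-- Oriented simplices are written as vertex lists in strictly increasing
-- order; a list of length m+1 is an m-simplex, the empty list (length 0)
-- is the empty (-1)-simplex of the reduced (augmented) chain complex.
Increasing : ∀ {n m} → Vec (Fin n) m → Set
Increasing σ = ∀ i j → i < j → lookup σ i < lookup σ j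

IsClique : ∀ {n m} → Graph n → Vec (Fin n) m → Set
IsClique H σ = ∀ i j → i < j → Adj H (lookup σ i) (lookup σ j)

IsFace : ∀ {n m} → Graph n → Vec (Fin n) m → Set
IsFace H σ = Increasing σ × IsClique H σ

record Chain {n : ℕ} (H : Graph n) (k : ℕ) : Set where
  field
    coeff   : Vec (Fin n) (suc k) → ℤ
    support : ∀ σ → coeff σ ≢ 0ℤ → IsFace H σ
open Chain public

sumFin : ∀ {m} → (Fin m → ℤ) → ℤ
sumFin {zero}  f = 0ℤ
sumFin {suc m} f = f zero + sumFin (λ i → f (suc i))

signFin : ∀ {m} → Fin m → ℤ
signFin zero    = 1ℤ
signFin (suc i) = - signFin i

-- For increasing w this is Σ over faces σ ⊃ w with w = σ minus its i-th
-- vertex of (-1)^i c(σ); for k = 0 and w = [] it is the augmentation.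
∂ : ∀ {n k} → (Vec (Fin n) (suc k) → ℤ) → Vec (Fin n) k → ℤ
∂ {n} {k} c w = sumFin {suc k} (λ i → signFin i * sumFin {n} (λ v → c (insertAt w i v)))

IsCycle : ∀ {n k} {H : Graph n} → Chain H k → Set
IsCycle γ = ∀ w → ∂ (coeff γ) w ≡ 0ℤ

IsBoundary : ∀ {n k} {H : Graph n} → Chain H k → Set
IsBoundary {n} {k} {H} γ = Σ (Chain H (suc k)) (λ β → ∀ σ → ∂ (coeff β) σ ≡ coeff γ σ)

RepresentsNonzeroClass : ∀ {n k} {H : Graph n} → Chain H k → Set
RepresentsNonzeroClass γ = IsCycle γ × ¬ IsBoundary γ

InVSupp : ∀ {n k} {H : Graph n} → Chain H k → Fin n → Set
InVSupp {n} {k} γ v = Σ (Vec (Fin n) (suc k)) (λ σ → coeff γ σ ≢ 0ℤ × Σ (Fin (suc k)) (λ i → lookup σ i ≡ v))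

VSuppAtLeast : ∀ {n k} {H : Graph n} → Chain H k → ℕ → Set
VSuppAtLeast {n} γ m = Σ (List (Fin n)) (λ L → Unique L × All (InVSupp γ) L × m Data.Nat.≤ length L)

{-# OPTIONS --safe #-}
module Submission where

-- A k-cycle c whose faces use a set S of at most 2k+1 vertices is a boundary, by induction on k
-- and |S|. Let v be the least vertex of S, so that v occurs in faces of c only as first vertex,
-- and write c = c′ + v ∗ α with α the link of v in c, a (k-1)-cycle, and c′ avoiding v, so that
-- ∂c′ = -α. First find δ with ∂δ = α whose faces can be coned from v: if every other vertex of S
-- lies in the link, δ = -c′ does; otherwise α lives on at most 2k-1 vertices and δ exists by
-- induction on k. Then c′ + δ is a k-cycle on S without v, hence c′ + δ = ∂β, and c = ∂(β - v ∗ δ).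

open import Defs hiding (sym)
open import Data.Nat using (ℕ; zero; suc; s≤s; z≤n)
import Data.Nat as ℕ
import Data.Nat.Properties as ℕₚ
open import Data.Fin using (Fin; zero; suc; _<_; _≟_)
import Data.Fin.Properties as Finₚ
open import Data.Integer as ℤ using (ℤ; 0ℤ)
import Data.Integer.Properties as ℤₚ
open import Data.Integer.Tactic.RingSolver using (solve-∀)
open import Algebra.Properties.Semiring.Sum ℤₚ.+-*-semiring
  using (sum; sum-cong-≋; ∑-distrib-+; *-distribˡ-sum; sum-replicate-zero)
open import Algebra.Properties.CommutativeSemigroup ℤₚ.*-commutativeSemigroup
  using (x∙yz≈y∙xz)
open import Data.Vec using (Vec; []; _∷_; lookup; insertAt)
open import Data.List using (List; []; _∷_; length; filter; allFin)
open import Data.List.Membership.Propositional using (_∈_)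
open import Data.List.Membership.Propositional.Properties using (∈-filter⁺; ∈-filter⁻; ∈-allFin)
open import Data.List.Properties using (filter-notAll)
open import Data.List.Relation.Unary.Any using (here; there)
open import Data.List.Relation.Unary.All as All using (All; all?)
open import Data.List.Relation.Unary.All.Properties using (all-filter; ¬All⇒Any¬)
open import Data.List.Relation.Unary.AllPairs as AllPairs using (AllPairs; _∷_)
import Data.List.Relation.Unary.AllPairs.Properties as AllPairsₚ
open import Data.Product using (Σ; ∃; _×_; _,_; proj₁; proj₂; uncurry)
open import Data.Sum using (_⊎_; inj₁; inj₂; [_,_]′)
open import Data.Unit using (⊤; tt)
open import Function using (_∘_)
open import Relation.Binary.PropositionalEquality
  using (_≡_; _≢_; refl; sym; trans; cong; cong₂; subst; module ≡-Reasoning)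
open import Relation.Nullary using (¬_; Dec; yes; no; ¬?; contradiction)
open import Relation.Nullary.Decidable using (_×-dec_; map′; decidable-stable)
open import Relation.Unary using (Decidable; _⊆_; _∩_)

private
  variable
    n m k : ℕ

-- The integer operations are opened only inside this module, because the theorem is stated
-- with the natural-number _+_ and _*_.
module _ where
  open import Data.Integer using (1ℤ; -1ℤ; _+_; _*_; -_; _-_)

  sumFin≡sum : (f : Fin m → ℤ) → sumFin f ≡ sum f
  sumFin≡sum {zero}  f = refl
  sumFin≡sum {suc m} f = cong (f zero +_) (sumFin≡sum (f ∘ suc))

  sumFin-cong : {f g : Fin m → ℤ} → (∀ i → f i ≡ g i) → sumFin f ≡ sumFin g
  sumFin-cong {f = f} {g} f≗g rewrite sumFin≡sum f | sumFin≡sum g = sum-cong-≋ f≗g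

  sumFin-+ : (f g : Fin m → ℤ) → sumFin (λ i → f i + g i) ≡ sumFin f + sumFin g
  sumFin-+ f g
    rewrite sumFin≡sum (λ i → f i + g i) | sumFin≡sum f | sumFin≡sum g = ∑-distrib-+ f g

  sumFin-*ˡ : (a : ℤ) (f : Fin m → ℤ) → sumFin (λ i → a * f i) ≡ a * sumFin f
  sumFin-*ˡ a f rewrite sumFin≡sum (λ i → a * f i) | sumFin≡sum f = sym (*-distribˡ-sum a f)

  sumFin-neg : (f : Fin m → ℤ) → sumFin (λ i → - f i) ≡ - sumFin f
  sumFin-neg f = begin
    sumFin (λ i → - f i)        ≡⟨ sumFin-cong (λ i → sym (ℤₚ.-1*i≡-i (f i))) ⟩
    sumFin (λ i → -1ℤ * f i)    ≡⟨ sumFin-*ˡ -1ℤ f ⟩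
    -1ℤ * sumFin f              ≡⟨ ℤₚ.-1*i≡-i (sumFin f) ⟩
    - sumFin f                  ∎
    where open ≡-Reasoning

  sumFin-zero : {f : Fin m → ℤ} → (∀ i → f i ≡ 0ℤ) → sumFin f ≡ 0ℤ
  sumFin-zero {m} f≗0 = trans (sumFin-cong f≗0) (trans (sumFin≡sum {m} (λ _ → 0ℤ)) (sum-replicate-zero m))

  kronecker : Fin n → Fin n → ℤ
  kronecker zero    zero    = 1ℤ
  kronecker zero    (suc _) = 0ℤ
  kronecker (suc _) zero    = 0ℤ
  kronecker (suc u) (suc v) = kronecker u v

  kronecker-refl : (v : Fin n) → kronecker v v ≡ 1ℤ
  kronecker-refl zero    = refl
  kronecker-refl (suc v) = kronecker-refl v

  kronecker-≢ : {u v : Fin n} → u ≢ v → kronecker u v ≡ 0ℤ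
  kronecker-≢ {u = zero}  {zero}  u≢v = contradiction refl u≢v
  kronecker-≢ {u = zero}  {suc v} _   = refl
  kronecker-≢ {u = suc u} {zero}  _   = refl
  kronecker-≢ {u = suc u} {suc v} u≢v = kronecker-≢ (u≢v ∘ cong suc)

  kronecker≢0⇒≡ : {u v : Fin n} → kronecker u v ≢ 0ℤ → u ≡ v
  kronecker≢0⇒≡ {u = u} {v} κ≢0 = decidable-stable (u ≟ v) (κ≢0 ∘ kronecker-≢)

  sumFin-kronecker : (v : Fin n) (a : ℤ) → sumFin (λ u → kronecker u v * a) ≡ a
  sumFin-kronecker {suc n} zero a = begin
    1ℤ * a + sumFin {n} (λ _ → 0ℤ * a)  ≡⟨ cong (1ℤ * a +_) (sumFin-zero {n} (λ _ → ℤₚ.*-zeroˡ a)) ⟩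
    1ℤ * a + 0ℤ                         ≡⟨ ℤₚ.+-identityʳ (1ℤ * a) ⟩
    1ℤ * a                              ≡⟨ ℤₚ.*-identityˡ a ⟩
    a                                   ∎
    where open ≡-Reasoning
  sumFin-kronecker (suc v) a = begin
    0ℤ * a + sumFin (λ u → kronecker u v * a)  ≡⟨ cong (0ℤ * a +_) (sumFin-kronecker v a) ⟩
    0ℤ * a + a                                 ≡⟨ ℤₚ.+-identityˡ a ⟩
    a                                          ∎
    where open ≡-Reasoning

  Coeffs : ℕ → ℕ → Set
  Coeffs n m = Vec (Fin n) m → ℤ

  infixl 6 _⊕_ _⊖_
  infixr 7 _·_
  infix  8 ⊝_

  _⊕_ : Coeffs n m → Coeffs n m → Coeffs n m
  (f ⊕ g) σ = f σ + g σ

  ⊝_ : Coeffs n m → Coeffs n m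
  (⊝ f) σ = - f σ

  _⊖_ : Coeffs n m → Coeffs n m → Coeffs n m
  f ⊖ g = f ⊕ ⊝ g

  _·_ : ℤ → Coeffs n m → Coeffs n m
  (a · f) σ = a * f σ

  ⊕-nonzero : (f g : Coeffs n m) (σ : Vec (Fin n) m) → (f ⊕ g) σ ≢ 0ℤ → f σ ≢ 0ℤ ⊎ g σ ≢ 0ℤ
  ⊕-nonzero f g σ ≢0 with f σ ℤ.≟ 0ℤ
  ... | yes f≡0 = inj₂ λ g≡0 → ≢0 (cong₂ _+_ f≡0 g≡0)
  ... | no  f≢0 = inj₁ f≢0

  ⊝-nonzero : (f : Coeffs n m) (σ : Vec (Fin n) m) → (⊝ f) σ ≢ 0ℤ → f σ ≢ 0ℤ
  ⊝-nonzero f σ ≢0 f≡0 = ≢0 (cong -_ f≡0)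

  cofaceSum : Coeffs n (suc k) → Vec (Fin n) k → Fin (suc k) → ℤ
  cofaceSum f w i = sumFin λ u → f (insertAt w i u)

  ∂-cong : {f g : Coeffs n (suc k)} → (∀ σ → f σ ≡ g σ) → ∀ w → ∂ f w ≡ ∂ g w
  ∂-cong f≗g w = sumFin-cong λ i → cong (signFin i *_) (sumFin-cong λ u → f≗g (insertAt w i u))

  ∂-zero : (w : Vec (Fin n) k) → ∂ (λ _ → 0ℤ) w ≡ 0ℤ
  ∂-zero {n} {k} w = sumFin-zero {suc k} λ i →
    trans (cong (signFin i *_) (sumFin-zero {n} λ _ → refl)) (ℤₚ.*-zeroʳ (signFin i))

  ∂-⊕ : (f g : Coeffs n (suc k)) → ∀ w → ∂ (f ⊕ g) w ≡ ∂ f w + ∂ g w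
  ∂-⊕ {n} {k} f g w = trans (sumFin-cong distrib) (sumFin-+ (signed f) (signed g))
    where
    signed : Coeffs n (suc k) → Fin (suc k) → ℤ
    signed h i = signFin i * cofaceSum h w i
    distrib : ∀ i → signed (f ⊕ g) i ≡ signed f i + signed g i
    distrib i = trans (cong (signFin i *_) (sumFin-+ (λ u → f (insertAt w i u)) (λ u → g (insertAt w i u))))
                      (ℤₚ.*-distribˡ-+ (signFin i) (cofaceSum f w i) (cofaceSum g w i))

  ∂-· : (a : ℤ) (f : Coeffs n (suc k)) → ∀ w → ∂ (a · f) w ≡ a * ∂ f w
  ∂-· a f w = trans (sumFin-cong pull) (sumFin-*ˡ a (λ i → signFin i * cofaceSum f w i))
    where
    pull : ∀ i → signFin i * cofaceSum (a · f) w i ≡ a * (signFin i * cofaceSum f w i)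
    pull i = trans (cong (signFin i *_) (sumFin-*ˡ a (λ u → f (insertAt w i u))))
                   (x∙yz≈y∙xz (signFin i) a (cofaceSum f w i))

  ∂-⊝ : (f : Coeffs n (suc k)) → ∀ w → ∂ (⊝ f) w ≡ - ∂ f w
  ∂-⊝ f w = begin
    ∂ (⊝ f) w       ≡⟨ ∂-cong (λ σ → sym (ℤₚ.-1*i≡-i (f σ))) w ⟩
    ∂ (-1ℤ · f) w   ≡⟨ ∂-· -1ℤ f w ⟩
    -1ℤ * ∂ f w     ≡⟨ ℤₚ.-1*i≡-i (∂ f w) ⟩
    - ∂ f w         ∎
    where open ≡-Reasoning

  ∂-⊖ : (f g : Coeffs n (suc k)) → ∀ w → ∂ (f ⊖ g) w ≡ ∂ f w - ∂ g w
  ∂-⊖ f g w = trans (∂-⊕ f (⊝ g) w) (cong (∂ f w +_) (∂-⊝ g w))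

  link : Fin n → Coeffs n (suc m) → Coeffs n m
  link v c τ = c (v ∷ τ)

  ∂-[] : (c : Coeffs n 1) → ∂ c [] ≡ sumFin (λ u → c (u ∷ []))
  ∂-[] c = trans (ℤₚ.+-identityʳ (1ℤ * Σc)) (ℤₚ.*-identityˡ Σc)
    where
    Σc : ℤ
    Σc = sumFin λ u → c (u ∷ [])

  ∂-∷ : (c : Coeffs n (suc (suc k))) (x : Fin n) (w : Vec (Fin n) k) →
        ∂ c (x ∷ w) ≡ sumFin (λ u → c (u ∷ x ∷ w)) - ∂ (link x c) w
  ∂-∷ {k = k} c x w = cong₂ _+_ (ℤₚ.*-identityˡ (sumFin λ u → c (u ∷ x ∷ w)))
                        (trans (sumFin-cong negate) (sumFin-neg signed))
    where
    signed : Fin (suc k) → ℤ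
    signed i = signFin i * cofaceSum (link x c) w i
    negate : ∀ i → - signFin i * cofaceSum c (x ∷ w) (suc i) ≡ - signed i
    negate i = sym (ℤₚ.neg-distribˡ-* (signFin i) (cofaceSum (link x c) w i))

  -- Every (-1)-chain is a cycle of the augmented complex.
  Cycle : Coeffs n m → Set
  Cycle {m = zero}  _ = ⊤
  Cycle {m = suc _} c = ∀ w → ∂ c w ≡ 0ℤ

  cone : Fin n → Coeffs n m → Coeffs n (suc m)
  cone v g (u ∷ τ) = kronecker u v * g τ

  cone-nonzero : (v : Fin n) (g : Coeffs n m) (u : Fin n) (τ : Vec (Fin n) m) →
                 cone v g (u ∷ τ) ≢ 0ℤ → u ≡ v × g τ ≢ 0ℤ
  cone-nonzero v g u τ ≢0 =
    kronecker≢0⇒≡ (λ κ≡0 → ≢0 (trans (cong (_* g τ) κ≡0) (ℤₚ.*-zeroˡ (g τ)))) ,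
    λ g≡0 → ≢0 (trans (cong (kronecker u v *_) g≡0) (ℤₚ.*-zeroʳ (kronecker u v)))

  ∂-cone-∷ : (v : Fin n) (g : Coeffs n (suc k)) (x : Fin n) (w : Vec (Fin n) k) →
             ∂ (cone v g) (x ∷ w) ≡ g (x ∷ w) - kronecker x v * ∂ g w
  ∂-cone-∷ v g x w =
    trans (∂-∷ (cone v g) x w) (cong₂ _-_ (sumFin-kronecker v (g (x ∷ w))) (∂-· (kronecker x v) g w))

  ∂-cone-cycle : (v : Fin n) (g : Coeffs n m) → Cycle g → ∀ w → ∂ (cone v g) w ≡ g w
  ∂-cone-cycle {m = zero}  v g _ [] = trans (∂-[] (cone v g)) (sumFin-kronecker v (g []))
  ∂-cone-cycle {m = suc _} v g ∂g≡0 (x ∷ w) = begin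
    ∂ (cone v g) (x ∷ w)                 ≡⟨ ∂-cone-∷ v g x w ⟩
    g (x ∷ w) - kronecker x v * ∂ g w    ≡⟨ cong (λ t → g (x ∷ w) - kronecker x v * t) (∂g≡0 w) ⟩
    g (x ∷ w) - kronecker x v * 0ℤ       ≡⟨ cong (λ t → g (x ∷ w) - t) (ℤₚ.*-zeroʳ (kronecker x v)) ⟩
    g (x ∷ w) + 0ℤ                       ≡⟨ ℤₚ.+-identityʳ (g (x ∷ w)) ⟩
    g (x ∷ w)                            ∎
    where open ≡-Reasoning

  deletion : Fin n → Coeffs n (suc m) → Coeffs n (suc m)
  deletion v c = c ⊖ cone v (link v c)

  deletion-nonzero : (v : Fin n) (c : Coeffs n (suc m)) (u : Fin n) (τ : Vec (Fin n) m) →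
                     deletion v c (u ∷ τ) ≢ 0ℤ → u ≢ v × c (u ∷ τ) ≢ 0ℤ
  deletion-nonzero v c u τ ≢0 = u≢v , λ c≡0 → ≢0 (trans (away u≢v) c≡0)
    where
    open ≡-Reasoning
    away : u ≢ v → deletion v c (u ∷ τ) ≡ c (u ∷ τ)
    away u≢v = begin
      c (u ∷ τ) - kronecker u v * c (v ∷ τ)  ≡⟨ cong (λ κ → c (u ∷ τ) - κ * c (v ∷ τ)) (kronecker-≢ u≢v) ⟩
      c (u ∷ τ) - 0ℤ                         ≡⟨ ℤₚ.+-identityʳ (c (u ∷ τ)) ⟩
      c (u ∷ τ)                              ∎
    u≢v : u ≢ v
    u≢v refl = ≢0 (begin
      c (v ∷ τ) - kronecker v v * c (v ∷ τ)  ≡⟨ cong (λ κ → c (v ∷ τ) - κ * c (v ∷ τ)) (kronecker-refl v) ⟩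
      c (v ∷ τ) - 1ℤ * c (v ∷ τ)             ≡⟨ cong (λ t → c (v ∷ τ) - t) (ℤₚ.*-identityˡ (c (v ∷ τ))) ⟩
      c (v ∷ τ) - c (v ∷ τ)                  ≡⟨ ℤₚ.+-inverseʳ (c (v ∷ τ)) ⟩
      0ℤ                                     ∎)

  OccursOnlyFirst : Fin n → Coeffs n (suc m) → Set
  OccursOnlyFirst v c = ∀ u τ i → lookup τ i ≡ v → c (u ∷ τ) ≡ 0ℤ

  link-cycle : (v : Fin n) (c : Coeffs n (suc m)) → OccursOnlyFirst v c → Cycle c → Cycle (link v c)
  link-cycle {m = zero}  v c _ _ = tt
  link-cycle {m = suc _} v c onlyFirst ∂c≡0 ρ = ℤₚ.neg-injective (begin
    - ∂ (link v c) ρ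
      ≡⟨ ℤₚ.+-identityˡ _ ⟨
    0ℤ - ∂ (link v c) ρ
      ≡⟨ cong (_- ∂ (link v c) ρ) (sumFin-zero λ u → onlyFirst u (v ∷ ρ) zero refl) ⟨
    sumFin (λ u → c (u ∷ v ∷ ρ)) - ∂ (link v c) ρ
      ≡⟨ ∂-∷ c v ρ ⟨
    ∂ c (v ∷ ρ)
      ≡⟨ ∂c≡0 (v ∷ ρ) ⟩
    0ℤ ∎)
    where open ≡-Reasoning

  ∂-deletion : (v : Fin n) (c : Coeffs n (suc m)) → OccursOnlyFirst v c → Cycle c →
               ∀ w → ∂ (deletion v c) w ≡ - link v c w
  ∂-deletion v c onlyFirst ∂c≡0 w = begin
    ∂ (deletion v c) w
      ≡⟨ ∂-⊖ c (cone v (link v c)) w ⟩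
    ∂ c w - ∂ (cone v (link v c)) w
      ≡⟨ cong₂ _-_ (∂c≡0 w) (∂-cone-cycle v (link v c) (link-cycle v c onlyFirst ∂c≡0) w) ⟩
    0ℤ - link v c w
      ≡⟨ ℤₚ.+-identityˡ _ ⟩
    - link v c w ∎
    where open ≡-Reasoning

  ∂-⊝-deletion : (v : Fin n) (c : Coeffs n (suc m)) → OccursOnlyFirst v c → Cycle c →
                 ∀ w → ∂ (⊝ deletion v c) w ≡ link v c w
  ∂-⊝-deletion v c onlyFirst ∂c≡0 w = begin
    ∂ (⊝ deletion v c) w  ≡⟨ ∂-⊝ (deletion v c) w ⟩
    - ∂ (deletion v c) w  ≡⟨ cong -_ (∂-deletion v c onlyFirst ∂c≡0 w) ⟩
    - - link v c w        ≡⟨ ℤₚ.neg-involutive (link v c w) ⟩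
    link v c w            ∎
    where open ≡-Reasoning

  deletion⊕filling-cycle : (v : Fin n) (c δ : Coeffs n (suc k)) → OccursOnlyFirst v c → Cycle c →
                           (∀ τ → ∂ δ τ ≡ link v c τ) → Cycle (deletion v c ⊕ δ)
  deletion⊕filling-cycle v c δ onlyFirst ∂c≡0 ∂δ≡link w = begin
    ∂ (deletion v c ⊕ δ) w      ≡⟨ ∂-⊕ (deletion v c) δ w ⟩
    ∂ (deletion v c) w + ∂ δ w  ≡⟨ cong₂ _+_ (∂-deletion v c onlyFirst ∂c≡0 w) (∂δ≡link w) ⟩
    - link v c w + link v c w   ≡⟨ ℤₚ.+-inverseˡ (link v c w) ⟩
    0ℤ                          ∎
    where open ≡-Reasoning

  ∂-cone-filling : (v : Fin n) (c δ : Coeffs n (suc k)) (β : Coeffs n (suc (suc k))) →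
                   (∀ τ → ∂ δ τ ≡ link v c τ) → (∀ σ → ∂ β σ ≡ (deletion v c ⊕ δ) σ) →
                   ∀ σ → ∂ (β ⊖ cone v δ) σ ≡ c σ
  ∂-cone-filling {n} {k} v c δ β ∂δ≡link ∂β≡c′ (x ∷ τ) = begin
    ∂ (β ⊖ cone v δ) (x ∷ τ)
      ≡⟨ ∂-⊖ β (cone v δ) (x ∷ τ) ⟩
    ∂ β (x ∷ τ) - ∂ (cone v δ) (x ∷ τ)
      ≡⟨ cong₂ _-_ (∂β≡c′ (x ∷ τ)) (∂-cone-∷ v δ x τ) ⟩
    (c (x ∷ τ) - κ * α τ + δ (x ∷ τ)) - (δ (x ∷ τ) - κ * ∂ δ τ)
      ≡⟨ cong (λ t → (c (x ∷ τ) - κ * α τ + δ (x ∷ τ)) - (δ (x ∷ τ) - κ * t)) (∂δ≡link τ) ⟩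
    (c (x ∷ τ) - κ * α τ + δ (x ∷ τ)) - (δ (x ∷ τ) - κ * α τ)
      ≡⟨ cancel (c (x ∷ τ)) (κ * α τ) (δ (x ∷ τ)) ⟩
    c (x ∷ τ) ∎
    where
    open ≡-Reasoning
    α : Coeffs n k
    α = link v c
    κ : ℤ
    κ = kronecker x v
    cancel : ∀ a b d → (a - b + d) - (d - b) ≡ a
    cancel = solve-∀

LookupPairwise : {A : Set} → (A → A → Set) → Vec A m → Set
LookupPairwise R σ = ∀ i j → i < j → R (lookup σ i) (lookup σ j)

pairwise-∷⁺ : {A : Set} {R : A → A → Set} {x : A} {σ : Vec A m} →
              LookupPairwise R σ → (∀ i → R x (lookup σ i)) → LookupPairwise R (x ∷ σ)
pairwise-∷⁺ Rσ Rx zero    (suc j) _         = Rx j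
pairwise-∷⁺ Rσ Rx (suc i) (suc j) (s≤s i<j) = Rσ i j i<j

pairwise-∷⁻ : {A : Set} {R : A → A → Set} {x : A} {σ : Vec A m} →
              LookupPairwise R (x ∷ σ) → LookupPairwise R σ × (∀ i → R x (lookup σ i))
pairwise-∷⁻ Rxσ = (λ i j i<j → Rxσ (suc i) (suc j) (s≤s i<j)) , λ j → Rxσ zero (suc j) (s≤s z≤n)

VSupp : Coeffs n m → Fin n → Set
VSupp {n} {m} c u = Σ (Vec (Fin n) m) λ σ → c σ ≢ 0ℤ × Σ (Fin m) λ i → lookup σ i ≡ u

anyVec? : ∀ m {P : Vec (Fin n) m → Set} → Decidable P → Dec (∃ P)
anyVec? zero    P? = map′ ([] ,_) (λ { ([] , p) → p }) (P? [])
anyVec? (suc m) P? = map′ (λ (u , τ , p) → u ∷ τ , p) (λ { (u ∷ τ , p) → u , τ , p })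
                          (Finₚ.any? λ u → anyVec? m (P? ∘ (u ∷_)))

VSupp? : (c : Coeffs n m) → Decidable (VSupp c)
VSupp? c u = anyVec? _ λ σ → ¬? (c σ ℤ.≟ 0ℤ) ×-dec Finₚ.any? λ i → lookup σ i ≟ u

open import Data.Nat using (ℕ; suc; _+_; _*_)

module _ {n : ℕ} (H : Graph n) where

  Joinable : Fin n → Fin n → Set
  Joinable v u = v < u × Adj H v u

  face-∷⁺ : {v : Fin n} {σ : Vec (Fin n) m} →
            IsFace H σ → (∀ i → Joinable v (lookup σ i)) → IsFace H (v ∷ σ)
  face-∷⁺ (inc , clq) joins =
    pairwise-∷⁺ {R = _<_} inc (proj₁ ∘ joins) , pairwise-∷⁺ {R = Adj H} clq (proj₂ ∘ joins)

  face-∷⁻ : {v : Fin n} {σ : Vec (Fin n) m} →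
            IsFace H (v ∷ σ) → IsFace H σ × (∀ i → Joinable v (lookup σ i))
  face-∷⁻ {v = v} {σ} (inc , clq) = (proj₁ inc⁻ , proj₁ clq⁻) , λ i → proj₂ inc⁻ i , proj₂ clq⁻ i
    where
    inc⁻ : LookupPairwise _<_ σ × (∀ i → v < lookup σ i)
    inc⁻ = pairwise-∷⁻ {R = _<_} inc
    clq⁻ : LookupPairwise (Adj H) σ × (∀ i → Adj H v (lookup σ i))
    clq⁻ = pairwise-∷⁻ {R = Adj H} clq

  record SupportedOn (P : Fin n → Set) (c : Coeffs n m) : Set where
    constructor supportedOn
    field
      face   : ∀ σ → c σ ≢ 0ℤ → IsFace H σ
      vertex : ∀ σ → c σ ≢ 0ℤ → ∀ i → P (lookup σ i)
  open SupportedOn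

  record IsBoundaryOn (P : Fin n → Set) (a : Coeffs n m) : Set where
    constructor boundaryOn
    field
      filling           : Coeffs n (suc m)
      filling-supported : SupportedOn P filling
      ∂filling          : ∀ σ → ∂ filling σ ≡ a σ

  Acyclic : ℕ → List (Fin n) → Set
  Acyclic m S = (c : Coeffs n m) → SupportedOn (_∈ S) c → Cycle c → IsBoundaryOn (_∈ S) c

  supported-mono : {P Q : Fin n → Set} {c : Coeffs n m} → P ⊆ Q → SupportedOn P c → SupportedOn Q c
  supported-mono P⊆Q supp = supportedOn (face supp) λ σ ≢0 i → P⊆Q (vertex supp σ ≢0 i)

  supported-⊕ : {P : Fin n → Set} {f g : Coeffs n m} → SupportedOn P f → SupportedOn P g → SupportedOn P (f ⊕ g)
  supported-⊕ {f = f} {g} suppf suppg = supportedOn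
    (λ σ ≢0 → [ face suppf σ , face suppg σ ]′ (⊕-nonzero f g σ ≢0))
    (λ σ ≢0 → [ vertex suppf σ , vertex suppg σ ]′ (⊕-nonzero f g σ ≢0))

  supported-⊝ : {P : Fin n → Set} {f : Coeffs n m} → SupportedOn P f → SupportedOn P (⊝ f)
  supported-⊝ {f = f} supp =
    supportedOn (λ σ → face supp σ ∘ ⊝-nonzero f σ) (λ σ → vertex supp σ ∘ ⊝-nonzero f σ)

  supported-⊖ : {P : Fin n → Set} {f g : Coeffs n m} → SupportedOn P f → SupportedOn P g → SupportedOn P (f ⊖ g)
  supported-⊖ suppf suppg = supported-⊕ suppf (supported-⊝ suppg)

  supported⇒vsupp⊆ : {P : Fin n → Set} {c : Coeffs n m} → SupportedOn P c → VSupp c ⊆ P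
  supported⇒vsupp⊆ supp (σ , ≢0 , i , refl) = vertex supp σ ≢0 i

  supported-∩-vsupp : {P : Fin n → Set} {c : Coeffs n m} → SupportedOn P c → SupportedOn (P ∩ VSupp c) c
  supported-∩-vsupp supp = supportedOn (face supp) λ σ ≢0 i → vertex supp σ ≢0 i , σ , ≢0 , i , refl

  supported-[]⇒zero : {c : Coeffs n (suc m)} → SupportedOn (_∈ []) c → ∀ σ → c σ ≡ 0ℤ
  supported-[]⇒zero {c = c} supp σ =
    decidable-stable (c σ ℤ.≟ 0ℤ) λ ≢0 → contradiction (vertex supp σ ≢0 zero) λ ()

  head-minimal : {u v : Fin n} {S : List (Fin n)} → All (v <_) S → u ∈ v ∷ S → ¬ u < v
  head-minimal v<S (here refl) = Finₚ.<-irrefl refl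
  head-minimal v<S (there u∈S) = Finₚ.<-asym (All.lookup v<S u∈S)

  ∈-tail : {u v : Fin n} {S : List (Fin n)} → u ∈ v ∷ S → u ≢ v → u ∈ S
  ∈-tail (here u≡v) u≢v = contradiction u≡v u≢v
  ∈-tail (there u∈S) _  = u∈S

  occursOnlyFirst : {v : Fin n} {S : List (Fin n)} {c : Coeffs n (suc m)} →
                    All (v <_) S → SupportedOn (_∈ v ∷ S) c → OccursOnlyFirst v c
  occursOnlyFirst {c = c} v<S supp u τ i τᵢ≡v = decidable-stable (c (u ∷ τ) ℤ.≟ 0ℤ) λ ≢0 →
    head-minimal v<S (vertex supp (u ∷ τ) ≢0 zero)
      (subst (u <_) τᵢ≡v (proj₁ (proj₂ (face-∷⁻ (face supp (u ∷ τ) ≢0)) i)))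

  deletion-supported : {v : Fin n} {S : List (Fin n)} {c : Coeffs n (suc m)} →
                       All (v <_) S → SupportedOn (_∈ v ∷ S) c → SupportedOn (_∈ S) (deletion v c)
  deletion-supported {v = v} {c = c} v<S supp = supportedOn
    (λ { (u ∷ τ) ≢0 → face supp (u ∷ τ) (proj₂ (deletion-nonzero v c u τ ≢0)) })
    (λ { (u ∷ τ) ≢0 i →
           ∈-tail (vertex supp (u ∷ τ) (proj₂ (deletion-nonzero v c u τ ≢0)) i) (avoids u τ ≢0 i) })
    where
    avoids : ∀ u τ → deletion v c (u ∷ τ) ≢ 0ℤ → ∀ i → lookup (u ∷ τ) i ≢ v
    avoids u τ ≢0 zero    = proj₁ (deletion-nonzero v c u τ ≢0)
    avoids u τ ≢0 (suc i) = proj₂ (deletion-nonzero v c u τ ≢0) ∘ occursOnlyFirst v<S supp u τ i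

  link-supported : {v : Fin n} {S : List (Fin n)} {c : Coeffs n (suc m)} →
                   SupportedOn (_∈ v ∷ S) c → SupportedOn (Joinable v ∩ (_∈ S)) (link v c)
  link-supported {v = v} {c = c} supp = supportedOn
    (λ τ ≢0 → proj₁ (face-∷⁻ (face supp (v ∷ τ) ≢0)))
    (λ τ ≢0 i → joins τ ≢0 i ,
                ∈-tail (vertex supp (v ∷ τ) ≢0 (suc i)) (Finₚ.<⇒≢ (proj₁ (joins τ ≢0 i)) ∘ sym))
    where
    joins : ∀ τ → link v c τ ≢ 0ℤ → ∀ i → Joinable v (lookup τ i)
    joins τ ≢0 = proj₂ (face-∷⁻ (face supp (v ∷ τ) ≢0))

  cone-supported : {v : Fin n} {S : List (Fin n)} {δ : Coeffs n m} →
                   SupportedOn (Joinable v ∩ (_∈ S)) δ → SupportedOn (_∈ v ∷ S) (cone v δ)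
  cone-supported {v = v} {S} {δ} supp = supportedOn
    (λ { (u ∷ τ) ≢0 → coneFace u τ (cone-nonzero v δ u τ ≢0) })
    (λ { (u ∷ τ) ≢0 → coneVertex u τ (cone-nonzero v δ u τ ≢0) })
    where
    coneFace : ∀ u τ → u ≡ v × δ τ ≢ 0ℤ → IsFace H (u ∷ τ)
    coneFace u τ (refl , δ≢0) = face-∷⁺ (face supp τ δ≢0) (proj₁ ∘ vertex supp τ δ≢0)
    coneVertex : ∀ u τ → u ≡ v × δ τ ≢ 0ℤ → ∀ i → lookup (u ∷ τ) i ∈ v ∷ S
    coneVertex u τ (refl , _)   zero    = here refl
    coneVertex u τ (refl , δ≢0) (suc i) = there (proj₂ (vertex supp τ δ≢0 i))

  link-isBoundary : {v : Fin n} {S : List (Fin n)} (c : Coeffs n (suc k)) →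
                    (∀ {T} → AllPairs _<_ T → length T ℕ.< 2 * k → Acyclic k T) →
                    AllPairs _<_ S → length S ℕ.≤ 2 * k → All (v <_) S →
                    SupportedOn (_∈ v ∷ S) c → Cycle c → IsBoundaryOn (Joinable v ∩ (_∈ S)) (link v c)
  link-isBoundary {k = k} {v = v} {S} c lower sorted |S|≤2k v<S supp cyc = fill (all? inLink? S)
    where
    inLink? : Decidable (VSupp (link v c))
    inLink? = VSupp? (link v c)
    onlyFirst : OccursOnlyFirst v c
    onlyFirst = occursOnlyFirst v<S supp
    link-on-S : SupportedOn (Joinable v ∩ (_∈ S)) (link v c)
    link-on-S = link-supported supp
    linkVertex : ∀ {u} → u ∈ S → VSupp (link v c) u → (Joinable v ∩ (_∈ S)) u
    linkVertex u∈S inLink = proj₁ (supported⇒vsupp⊆ link-on-S inLink) , u∈S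
    T : List (Fin n)
    T = filter inLink? S
    toT : (Joinable v ∩ (_∈ S)) ∩ VSupp (link v c) ⊆ (_∈ T)
    toT ((_ , u∈S) , inLink) = ∈-filter⁺ inLink? u∈S inLink
    link-on-T : SupportedOn (_∈ T) (link v c)
    link-on-T = supported-mono toT (supported-∩-vsupp link-on-S)
    fromT : (_∈ T) ⊆ Joinable v ∩ (_∈ S)
    fromT u∈T = uncurry linkVertex (∈-filter⁻ inLink? {xs = S} u∈T)
    fill : Dec (All (VSupp (link v c)) S) → IsBoundaryOn (Joinable v ∩ (_∈ S)) (link v c)
    fill (yes allInLink) =
      boundaryOn (⊝ deletion v c)
                 (supported-mono toLink (supported-⊝ (deletion-supported v<S supp)))
                 (∂-⊝-deletion v c onlyFirst cyc)
      where
      toLink : (_∈ S) ⊆ Joinable v ∩ (_∈ S)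
      toLink u∈S = linkVertex u∈S (All.lookup allInLink u∈S)
    fill (no notAll) = boundaryOn δ (supported-mono fromT δ-on-T) ∂δ
      where
      |T|<2k : length T ℕ.< 2 * k
      |T|<2k = ℕₚ.<-≤-trans (filter-notAll inLink? S (¬All⇒Any¬ inLink? S notAll)) |S|≤2k
      open IsBoundaryOn (lower (AllPairsₚ.filter⁺ inLink? sorted) |T|<2k
                               (link v c) link-on-T (link-cycle v c onlyFirst cyc))
        renaming (filling to δ; filling-supported to δ-on-T; ∂filling to ∂δ)

  -- m counts the vertices of a simplex, so the bound |S| < 2m reads |S| ≤ 2k+1 in dimension k = m-1.
  few-vertices⇒acyclic : ∀ m {S} → AllPairs _<_ S → length S ℕ.< 2 * m → Acyclic m S
  few-vertices⇒acyclic zero _ ()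
  few-vertices⇒acyclic (suc k) {[]} _ _ c supp _ =
    boundaryOn (λ _ → 0ℤ)
               (supportedOn (λ _ 0≢0 → contradiction refl 0≢0) (λ _ 0≢0 → contradiction refl 0≢0))
               (λ σ → trans (∂-zero σ) (sym (supported-[]⇒zero supp σ)))
  few-vertices⇒acyclic (suc k) {v ∷ S} (v<S ∷ sorted) |vS|<2m c supp cyc =
    boundaryOn (β ⊖ cone v δ)
               (supported-⊖ (supported-mono there β-on-S) (cone-supported δ-supp))
               (∂-cone-filling v c δ β ∂δ ∂β)
    where
    |S|≤2k : length S ℕ.≤ 2 * k
    |S|≤2k = ℕ.s≤s⁻¹ (ℕ.s≤s⁻¹ (subst (ℕ._<_ (suc (length S))) (ℕₚ.*-suc 2 k) |vS|<2m))
    open IsBoundaryOn (link-isBoundary c (few-vertices⇒acyclic k) sorted |S|≤2k v<S supp cyc)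
      renaming (filling to δ; filling-supported to δ-supp; ∂filling to ∂δ)
    open IsBoundaryOn (few-vertices⇒acyclic (suc k) sorted (ℕₚ.<⇒≤ |vS|<2m) (deletion v c ⊕ δ)
                         (supported-⊕ (deletion-supported v<S supp) (supported-mono proj₂ δ-supp))
                         (deletion⊕filling-cycle v c δ (occursOnlyFirst v<S supp) cyc ∂δ))
      renaming (filling to β; filling-supported to β-on-S; ∂filling to ∂β)

vsuppList : Coeffs n m → List (Fin n)
vsuppList c = filter (VSupp? c) (allFin _)

vsuppList-sorted : (c : Coeffs n m) → AllPairs _<_ (vsuppList c)
vsuppList-sorted c = AllPairsₚ.filter⁺ (VSupp? c) (AllPairsₚ.tabulate⁺-< (λ i<j → i<j))

vsuppList-supported : {H : Graph n} (c : Coeffs n m) → (∀ σ → c σ ≢ 0ℤ → IsFace H σ) →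
                      SupportedOn H (_∈ vsuppList c) c
vsuppList-supported c faces =
  supportedOn faces λ σ ≢0 i → ∈-filter⁺ (VSupp? c) (∈-allFin _) (σ , ≢0 , i , refl)

isBoundaryOn⇒isBoundary : {H : Graph n} {P : Fin n → Set} (γ : Chain H k) →
                          IsBoundaryOn H P (coeff γ) → IsBoundary γ
isBoundaryOn⇒isBoundary γ (boundaryOn β (supportedOn faces _) ∂β) = record { coeff = β ; support = faces } , ∂β

lemma5p3 : ∀ {n : ℕ} (H : Graph n) (k : ℕ) (γ : Chain H k) → RepresentsNonzeroClass γ → VSuppAtLeast γ (2 * k + 2)
lemma5p3 {n} H k γ (cyc , ¬boundary) = decide (2 * k + 2 ℕ.≤? length V)
  where
  c : Coeffs n (suc k)
  c = coeff γ
  V : List (Fin n)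
  V = vsuppList c
  decide : Dec (2 * k + 2 ℕ.≤ length V) → VSuppAtLeast γ (2 * k + 2)
  decide (yes enough) = V , AllPairs.map Finₚ.<⇒≢ (vsuppList-sorted c) , all-filter (VSupp? c) (allFin n) , enough
  decide (no few) = contradiction (isBoundaryOn⇒isBoundary γ bounds) ¬boundary
    where
    |V|<2[1+k] : length V ℕ.< 2 * suc k
    |V|<2[1+k] = subst (length V ℕ.<_) (trans (ℕₚ.+-comm (2 * k) 2) (sym (ℕₚ.*-suc 2 k))) (ℕₚ.≰⇒> few)
    bounds : IsBoundaryOn H (_∈ V) c
    bounds = few-vertices⇒acyclic H (suc k) (vsuppList-sorted c) |V|<2[1+k] c (vsuppList-supported c (support γ)) cyc
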